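{- Let $\Phi$ be a function on CP problems such that for each CP problem $(\mathcal{R}/\mathcal{S},L)$: if there are TRSs $\mathcal{R}_1,\mathcal{R}_2$ with $\mathcal{R}=\mathcal{R}_1\cup\mathcal{R}_2$ and a matrix interpretation $\mathcal{M}$ with constant growth such that $\mathcal{R}_1\subseteq\succsim^{\mathrm{ncp}}_{\mathcal{M}}$, $\mathcal{R}_2\subseteq\succ_{\mathcal{M}}$ and $\mathcal{S}\subseteq\succsim_{\mathcal{M}}$, then $\Phi(\mathcal{R}/\mathcal{S},L)=\{(\mathcal{R}_1/(\mathcal{R}_2\cup\mathcal{S}),L,f)\}$ for some such $\mathcal{R}_1,\mathcal{R}_2$, where $f(n)=n$; otherwise $\Phi(\mathcal{R}/\mathcal{S},L)=\{(\mathcal{R}/\mathcal{S},L,\mathbf{0})\}$. Then $\Phi$ is a sound CP processor.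
   Context: A matrix interpretation $\mathcal{M}$ of dimension $d$ interprets each $n$-ary $f$ as $f_{\mathcal{M}}(\vec x_1,\dots,\vec x_n)=F_1\vec x_1+\dots+F_n\vec x_n+\vec f$, $F_i\in\mathbb{N}^{d\times d}$, $\vec f\in\mathbb{N}^d$, $(F_i)_{(1,1)}\ge1$. On $\mathbb{N}^d$: $\succsim$ is pointwise $\ge$; $\vec u\succ\vec v$ iff $u_1>v_1$ and $\vec u\succsim\vec v$. $s\succ_{\mathcal{M}}t$ ($s\succsim_{\mathcal{M}}t$) iff $[\alpha]_{\mathcal{M}}(s)\succ[\alpha]_{\mathcal{M}}(t)$ ($\succsim$) for all assignments $\alpha$. Constant growth: there is a matrix $A$ with $M_1\cdots M_p\le A$ for all $p$ and all matrices $M_1,\dots,M_p$ occurring in $\mathcal{M}$. Writing $[\alpha]_{\mathcal{M}}(s)=S_1\alpha(x_1)+\dots+S_k\alpha(x_k)+\vec s$ (variables of $s,t$ among $x_1,\dots,x_k$), the non-constant part is $S_1\alpha(x_1)+\dots+S_k\alpha(x_k)$, and $s\succsim^{\mathrm{ncp}}_{\mathcal{M}}t$ iff the non-constant part of $s$ is $\succsim$ that of $t$ for all $\alpha$. $\to_{\mathcal{R}/\mathcal{S}}=\to_{\mathcal{S}}^*\cdot\to_{\mathcal{R}}\cdot\to_{\mathcal{S}}^*$; $\mathrm{cp}(n,\to,L)=\sup\{\mathrm{dl}(t,\to)\mid t\in L,|t|\le n\}$ with $\mathrm{dl}(t,\to)=\sup\{m\mid\exists u,t\to^mu\}$. A CP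 problem is a pair $(\mathcal{R}/\mathcal{S},L)$ of a relative TRS and a set of terms. A CP processor maps a CP problem to a finite set of triples $(\mathcal{R}_i/\mathcal{S}_i,L_i,f_i)$ with $f_i:\mathbb{N}\to\mathbb{N}$; it is sound if $\mathrm{cp}(n,\to_{\mathcal{R}/\mathcal{S}},L)=O(\sum_i f_i(n)+\sum_i\mathrm{cp}(n,\to_{\mathcal{R}_i/\mathcal{S}_i},L_i))$ for every input. $\mathbf{0}$ is the zero function. -}

module Defs where

open import Data.Nat using (ℕ; zero; suc; _+_; _*_; _≤_; _<_)
open import Data.Fin using (Fin; zero; suc)
open import Data.Vec using (Vec; []; _∷_)
open import Data.List using (List; []; _∷_; _++_; map)
open import Data.List.Membership.Propositional using (_∈_)
open import Data.Product using (Σ; _×_; _,_; ∃; proj₁; proj₂)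
open import Data.Sum using (_⊎_)
open import Relation.Nullary using (¬_)
open import Relation.Binary.PropositionalEquality using (_≡_)
open import Relation.Binary.Construct.Closure.ReflexiveTransitive using (Star)

∑ : (n : ℕ) → (Fin n → ℕ) → ℕ
∑ zero    g = 0
∑ (suc n) g = g zero + ∑ n (λ i → g (suc i))

module Sig (k : ℕ) (ar : Fin k → ℕ) where

  Sym : Set
  Sym = Fin k

  data Term : Set where
    var : ℕ → Term
    fun : (f : Sym) → Vec Term (ar f) → Term

  mutual
    size : Term → ℕ
    size (var x)    = 1
    size (fun f ts) = suc (sizes ts)

    sizes : ∀ {n} → Vec Term n → ℕ
    sizes []       = 0
    sizes (t ∷ ts) = size t + sizes ts

  mutual
    data _∈V_ (x : ℕ) : Term → Set where
      here : x ∈V var x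
      arg  : ∀ {f ts} → x ∈Vs ts → x ∈V fun f ts

    data _∈Vs_ (x : ℕ) : ∀ {n} → Vec Term n → Set where
      here  : ∀ {n t} {ts : Vec Term n} → x ∈V t → x ∈Vs (t ∷ ts)
      there : ∀ {n t} {ts : Vec Term n} → x ∈Vs ts → x ∈Vs (t ∷ ts)

  IsVar : Term → Set
  IsVar t = Σ ℕ (λ x → t ≡ var x)

  record Rule : Set where
    constructor rule
    field
      lhs : Term
      rhs : Term
      .lhs-nonvar : ¬ IsVar lhs
      .var-cond   : ∀ x → x ∈V rhs → x ∈V lhs
  open Rule public

  -- a TRS is a finite set of rules, represented by a list
  TRS : Set
  TRS = List Rule

  _≈TRS_ : TRS → TRS → Set
  R ≈TRS R' = ∀ ρ → (ρ ∈ R → ρ ∈ R') × (ρ ∈ R' → ρ ∈ R)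

  _∪_ : TRS → TRS → TRS
  R ∪ R' = R ++ R'

  Subst : Set
  Subst = ℕ → Term

  mutual
    _·_ : Term → Subst → Term
    var x    · σ = σ x
    fun f ts · σ = fun f (ts ·s σ)

    _·s_ : ∀ {n} → Vec Term n → Subst → Vec Term n
    []       ·s σ = []
    (t ∷ ts) ·s σ = (t · σ) ∷ (ts ·s σ)

  mutual
    data Step (R : TRS) : Term → Term → Set where
      root  : ∀ {ρ} → ρ ∈ R → (σ : Subst) → Step R (lhs ρ · σ) (rhs ρ · σ)
      inner : ∀ {f} {ts us : Vec Term (ar f)} → StepArgs R ts us →
              Step R (fun f ts) (fun f us)

    data StepArgs (R : TRS) : ∀ {n} → Vec Term n → Vec Term n → Set where
      here  : ∀ {n t u} {ts : Vec Term n} → Step R t u → StepArgs R (t ∷ ts) (u ∷ ts)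
      there : ∀ {n t} {ts us : Vec Term n} → StepArgs R ts us → StepArgs R (t ∷ ts) (t ∷ us)

  RelStep : TRS → TRS → Term → Term → Set
  RelStep R S t u = Σ Term λ t' → Σ Term λ u' →
    Star (Step S) t t' × Step R t' u' × Star (Step S) u' u

  data Iter (_⟶_ : Term → Term → Set) : ℕ → Term → Term → Set where
    refl : ∀ {t} → Iter _⟶_ zero t t
    step : ∀ {m t u v} → t ⟶ u → Iter _⟶_ m u v → Iter _⟶_ (suc m) t v

  record CPProblem : Set₁ where
    constructor cpp
    field
      R : TRS
      S : TRS
      L : Term → Set
  open CPProblem public

  DlBound : TRS → TRS → Term → ℕ → Set
  DlBound R S t b = ∀ m u → Iter (RelStep R S) m t u → m ≤ b

  CpBound : CPProblem → ℕ → ℕ → Set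
  CpBound P n b = ∀ t → L P t → size t ≤ n → DlBound (R P) (S P) t b

  record Triple : Set₁ where
    constructor triple
    field
      prob  : CPProblem
      bound : ℕ → ℕ
  open Triple public

  CPProcessor : Set₁
  CPProcessor = CPProblem → List Triple

  -- RhsBound n Ts K : K = Σ_i f_i(n) + Σ_i k_i for some upper bounds
  -- k_i of cp(n, →_{R_i/S_i}, L_i);  i.e. K is an upper bound of
  -- Σ_i f_i(n) + Σ_i cp(n, →_{R_i/S_i}, L_i)  (in ℕ ∪ {∞}).
  data RhsBound (n : ℕ) : List Triple → ℕ → Set₁ where
    []  : RhsBound n [] 0
    _∷_ : ∀ {T Ts b K} → CpBound (prob T) n b → RhsBound n Ts K →
          RhsBound n (T ∷ Ts) (bound T n + b + K)

  -- soundness: cp(n,→_{R/S},L) = O(Σ f_i(n) + Σ cp(n,→_{R_i/S_i},L_i)),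
  -- with values in ℕ ∪ {∞}: there are c, N such that for all n ≥ N,
  -- cp(n, ...) ≤ c · (right-hand side); the inequality  x ≤ c·sup Y  is
  -- expressed as "c·K bounds x for every upper bound K of Y".
  Sound : CPProcessor → Set₁
  Sound Φ = ∀ P → Σ ℕ λ c → Σ ℕ λ N → ∀ n → N ≤ n →
    ∀ K → RhsBound n (Φ P) K → CpBound P n (c * K)

  -- Matrix interpretations of dimension D = suc d  (so D ≥ 1)

  module Matrices (D : ℕ) where
    Vect : Set
    Vect = Fin D → ℕ

    Mat : Set
    Mat = Fin D → Fin D → ℕ

    0v : Vect
    0v _ = 0

    _+v_ : Vect → Vect → Vect
    (u +v v) i = u i + v i

    _*v_ : Mat → Vect → Vect
    (M *v v) i = ∑ D (λ j → M i j * v j)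

    _*M_ : Mat → Mat → Mat
    (M *M N) i j = ∑ D (λ l → M i l * N l j)

    δ : ∀ {n} → Fin n → Fin n → ℕ
    δ zero    zero    = 1
    δ zero    (suc _) = 0
    δ (suc _) zero    = 0
    δ (suc i) (suc j) = δ i j

    Id : Mat
    Id = δ

    prodM : List Mat → Mat
    prodM []       = Id
    prodM (M ∷ Ms) = M *M prodM Ms

    _≤M_ : Mat → Mat → Set
    M ≤M N = ∀ i j → M i j ≤ N i j

    _≿_ : Vect → Vect → Set
    u ≿ v = ∀ i → v i ≤ u i

  module _ (d : ℕ) where
    open Matrices (suc d)

    record MatrixInterpretation : Set where
      field
        coeff : (f : Sym) → Fin (ar f) → Mat
        const : Sym → Vect
        coeff-pos : ∀ f i → 1 ≤ coeff f i zero zero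

  module MI {d : ℕ} (M : MatrixInterpretation d) where
    open Matrices (suc d) public
    open MatrixInterpretation M

    _≻_ : Vect → Vect → Set
    u ≻ v = v zero < u zero × u ≿ v

    Assignment : Set
    Assignment = ℕ → Vect

    mutual
      evalWith : (Sym → Vect) → Assignment → Term → Vect
      evalWith c α (var x)    = α x
      evalWith c α (fun f ts) = evalArgs c α (coeff f) ts +v c f

      evalArgs : ∀ {n} → (Sym → Vect) → Assignment → (Fin n → Mat) → Vec Term n → Vect
      evalArgs c α Fs []       = 0v
      evalArgs c α Fs (t ∷ ts) = (Fs zero *v evalWith c α t) +v evalArgs c α (λ (i : Fin _) → Fs (suc i)) ts

    eval : Assignment → Term → Vect
    eval = evalWith const

    -- non-constant part S_1 α(x_1) + … + S_k α(x_k) of [α]_M(t):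
    -- the evaluation with all constant vectors set to 0
    ncp : Assignment → Term → Vect
    ncp = evalWith (λ _ → 0v)

    _≻M_ : Term → Term → Set
    s ≻M t = ∀ α → eval α s ≻ eval α t

    _≿M_ : Term → Term → Set
    s ≿M t = ∀ α → eval α s ≿ eval α t

    _≿ncp_ : Term → Term → Set
    s ≿ncp t = ∀ α → ncp α s ≿ ncp α t

    ConstantGrowth : Set
    ConstantGrowth = Σ Mat λ A →
      ∀ (ps : List (Σ Sym λ f → Fin (ar f))) →
        prodM (map (λ p → coeff (proj₁ p) (proj₂ p)) ps) ≤M A

  _⊆_ : TRS → (Term → Term → Set) → Set
  R ⊆ rel = ∀ ρ → ρ ∈ R → rel (lhs ρ) (rhs ρ)

  Applicable : CPProblem → TRS → TRS → Set
  Applicable P R₁ R₂ =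
    (R P ≈TRS (R₁ ∪ R₂)) ×
    Σ ℕ λ d → Σ (MatrixInterpretation d) λ M →
      MI.ConstantGrowth M ×
      (R₁ ⊆ MI._≿ncp_ M) × (R₂ ⊆ MI._≻M_ M) × (S P ⊆ MI._≿M_ M)

  IsProcessor7p4 : CPProcessor → Set₁
  IsProcessor7p4 Φ = ∀ P →
      (Σ TRS λ R₁ → Σ TRS λ R₂ → Applicable P R₁ R₂ ×
         Σ Triple λ T → (Φ P ≡ T ∷ []) ×
           (R (prob T) ≈TRS R₁) × (S (prob T) ≈TRS (R₂ ∪ S P)) ×
           (L (prob T) ≡ L P) × (∀ n → bound T n ≡ n))
    ⊎ ((¬ Σ TRS λ R₁ → Σ TRS λ R₂ → Applicable P R₁ R₂) ×
         Σ Triple λ T → (Φ P ≡ T ∷ []) ×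
           (R (prob T) ≈TRS R P) × (S (prob T) ≈TRS S P) ×
           (L (prob T) ≡ L P) × (∀ n → bound T n ≡ 0))

module Submission where

-- Measure a term t by its potential
-- pot t = ([0](t))₁, the first component of its value at the zero
-- assignment.  Steps with R₂ ∪ S never increase the potential and
-- R₂-steps strictly decrease it.  An R₁-step may increase it, but only
-- by (P·e)₁ where e is a fixed vector (the constant parts of the R₁
-- right-hand sides) and P is a product of coefficient matrices, hence
-- bounded by the constant-growth matrix A: an R₁-step costs at most a
-- constant E.  Constant growth also gives pot t ≤ G·|t|.  So in an
-- R/S-derivation with m₁ R₁-steps there are at most G·|t| + E·m₁
-- R₂-steps, while the m₁ R₁-steps form an R₁/(R₂ ∪ S)-derivation, so
-- m₁ is bounded by the complexity of the output problem.

open import Defs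
open import Data.Nat using (ℕ; zero; suc; _+_; _*_; _≤_; _<_; z≤n; s≤s; >-nonZero)
open import Data.Nat.Properties
open import Data.Nat.Tactic.RingSolver using (solve-∀)
open import Data.Fin using (Fin; zero; suc)
open import Data.Vec using (Vec; []; _∷_)
open import Data.List using (List; []; _∷_; map)
open import Data.List.Membership.Propositional using (_∈_)
open import Data.List.Membership.Propositional.Properties using (∈-++⁺ˡ; ∈-++⁺ʳ; ∈-++⁻)
open import Data.List.Relation.Binary.Subset.Propositional using () renaming (_⊆_ to _⊆ₗ_)
open import Data.List.Relation.Unary.Any using (here; there)
open import Data.Product using (Σ; _×_; _,_; proj₁; proj₂)
open import Data.Sum using (_⊎_; inj₁; inj₂)
import Data.Sum as Sum
open import Relation.Binary.Construct.Closure.ReflexiveTransitive using (Star; ε; _◅_; _◅◅_)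
import Relation.Binary.Construct.Closure.ReflexiveTransitive as Star
open import Relation.Binary.PropositionalEquality
open import Function using (case_of_)
open import Algebra.Properties.CommutativeSemigroup +-commutativeSemigroup using (interchange; xy∙z≈xz∙y)

∑-cong : ∀ n {g h : Fin n → ℕ} → (∀ i → g i ≡ h i) → ∑ n g ≡ ∑ n h
∑-cong zero    e = refl
∑-cong (suc n) e = cong₂ _+_ (e zero) (∑-cong n (λ i → e (suc i)))

∑-mono : ∀ n {g h : Fin n → ℕ} → (∀ i → g i ≤ h i) → ∑ n g ≤ ∑ n h
∑-mono zero    e = z≤n
∑-mono (suc n) e = +-mono-≤ (e zero) (∑-mono n (λ i → e (suc i)))

∑-zero : ∀ n → ∑ n (λ _ → 0) ≡ 0
∑-zero zero    = refl
∑-zero (suc n) = ∑-zero n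

∑-+ : ∀ n (g h : Fin n → ℕ) → ∑ n (λ i → g i + h i) ≡ ∑ n g + ∑ n h
∑-+ zero    g h = refl
∑-+ (suc n) g h = trans (cong (g zero + h zero +_) (∑-+ n _ _)) (interchange (g zero) (h zero) _ _)

∑-*ˡ : ∀ n a (g : Fin n → ℕ) → ∑ n (λ i → a * g i) ≡ a * ∑ n g
∑-*ˡ zero    a g = sym (*-zeroʳ a)
∑-*ˡ (suc n) a g = trans (cong (a * g zero +_) (∑-*ˡ n a _)) (sym (*-distribˡ-+ a (g zero) _))

∑-*ʳ : ∀ n a (g : Fin n → ℕ) → ∑ n (λ i → g i * a) ≡ ∑ n g * a
∑-*ʳ n a g = trans (∑-cong n (λ i → *-comm (g i) a)) (trans (∑-*ˡ n a g) (*-comm a _))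

∑-swap : ∀ n m (g : Fin n → Fin m → ℕ) → ∑ n (λ i → ∑ m (g i)) ≡ ∑ m (λ j → ∑ n (λ i → g i j))
∑-swap zero    m g = sym (∑-zero m)
∑-swap (suc n) m g = trans (cong (∑ m (g zero) +_) (∑-swap n m (λ i → g (suc i)))) (sym (∑-+ m (g zero) _))

∑-term : ∀ n (g : Fin n → ℕ) j → g j ≤ ∑ n g
∑-term (suc n) g zero    = m≤m+n _ _
∑-term (suc n) g (suc j) = ≤-trans (∑-term n (λ i → g (suc i)) j) (m≤n+m _ _)

suc-distrib : ∀ r e m → suc (r + e + suc e * m) ≡ r + suc e * suc m
suc-distrib = solve-∀

linear-combination : ∀ g e x y → g * x + e * y ≤ (g + e) * (x + y + 0)
linear-combination g e x y = subst (g * x + e * y ≤_) (sym (expand g e x y)) (m≤m+n _ _)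
  where
    expand : ∀ g e x y → (g + e) * (x + y + 0) ≡ (g * x + e * y) + (g * y + e * x)
    expand = solve-∀

module OverSignature (k : ℕ) (ar : Fin k → ℕ) where
  open Sig k ar

  module MatrixAlgebra (D : ℕ) where
    open Matrices D

    ∑-δ : ∀ n (i : Fin n) (v : Fin n → ℕ) → ∑ n (λ j → δ i j * v j) ≡ v i
    ∑-δ (suc n) zero    v = trans (cong₂ _+_ (*-identityˡ (v zero)) (∑-zero n)) (+-identityʳ _)
    ∑-δ (suc n) (suc i) v = ∑-δ n i (λ j → v (suc j))

    δ-sym : ∀ {n} (i j : Fin n) → δ i j ≡ δ j i
    δ-sym zero    zero    = refl
    δ-sym zero    (suc j) = refl
    δ-sym (suc i) zero    = refl
    δ-sym (suc i) (suc j) = δ-sym i j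

    *v-cong : ∀ M {u v : Vect} → (∀ j → u j ≡ v j) → ∀ i → (M *v u) i ≡ (M *v v) i
    *v-cong M e i = ∑-cong D (λ j → cong (M i j *_) (e j))

    *v-mono : ∀ M {u v : Vect} → (∀ j → u j ≤ v j) → ∀ i → (M *v u) i ≤ (M *v v) i
    *v-mono M e i = ∑-mono D (λ j → *-monoʳ-≤ (M i j) (e j))

    *v-monoˡ : ∀ M N → M ≤M N → ∀ v i → (M *v v) i ≤ (N *v v) i
    *v-monoˡ M N le v i = ∑-mono D (λ j → *-monoˡ-≤ (v j) (le i j))

    *v-+ : ∀ M u v i → (M *v (u +v v)) i ≡ (M *v u) i + (M *v v) i
    *v-+ M u v i = trans (∑-cong D (λ j → *-distribˡ-+ (M i j) (u j) (v j))) (∑-+ D _ _)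

    *v-0 : ∀ M i → (M *v 0v) i ≡ 0
    *v-0 M i = trans (∑-cong D (λ j → *-zeroʳ (M i j))) (∑-zero D)

    *v-assoc : ∀ M N v i → ((M *M N) *v v) i ≡ (M *v (N *v v)) i
    *v-assoc M N v i = begin
        ∑ D (λ j → ∑ D (λ l → M i l * N l j) * v j)    ≡⟨ ∑-cong D (λ j → sym (∑-*ʳ D (v j) (λ l → M i l * N l j))) ⟩
        ∑ D (λ j → ∑ D (λ l → M i l * N l j * v j))    ≡⟨ ∑-swap D D (λ j l → M i l * N l j * v j) ⟩
        ∑ D (λ l → ∑ D (λ j → M i l * N l j * v j))    ≡⟨ ∑-cong D (λ l → ∑-cong D (λ j → *-assoc (M i l) (N l j) (v j))) ⟩
        ∑ D (λ l → ∑ D (λ j → M i l * (N l j * v j)))  ≡⟨ ∑-cong D (λ l → ∑-*ˡ D (M i l) (λ j → N l j * v j)) ⟩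
        ∑ D (λ l → M i l * ∑ D (λ j → N l j * v j))    ∎
      where open ≡-Reasoning

    *M-assoc : ∀ M N Q i j → ((M *M N) *M Q) i j ≡ (M *M (N *M Q)) i j
    *M-assoc M N Q i j = *v-assoc M N (λ l → Q l j) i

    Id-*v : ∀ v i → (Id *v v) i ≡ v i
    Id-*v v i = ∑-δ D i v

    Id-*M : ∀ M i j → (Id *M M) i j ≡ M i j
    Id-*M M i j = Id-*v (λ l → M l j) i

    *M-Id : ∀ M i j → (M *M Id) i j ≡ M i j
    *M-Id M i j = trans (∑-cong D (λ l → trans (*-comm (M i l) (δ l j)) (cong (_* M i l) (δ-sym l j))))
                        (∑-δ D j (M i))

  mutual
    step-mono : ∀ {Rs Rs′} → Rs ⊆ₗ Rs′ → ∀ {t u} → Step Rs t u → Step Rs′ t u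
    step-mono inc (root m σ) = root (inc m) σ
    step-mono inc (inner p)  = inner (args-mono inc p)

    args-mono : ∀ {Rs Rs′} → Rs ⊆ₗ Rs′ → ∀ {n} {ts us : Vec Term n} →
                StepArgs Rs ts us → StepArgs Rs′ ts us
    args-mono inc (here p)  = here (step-mono inc p)
    args-mono inc (there p) = there (args-mono inc p)

  star-mono : ∀ {Rs Rs′} → Rs ⊆ₗ Rs′ → ∀ {t u} → Star (Step Rs) t u → Star (Step Rs′) t u
  star-mono inc = Star.map (step-mono inc)

  mutual
    step-split : ∀ {Rs} R₁ {R₂} → Rs ⊆ₗ R₁ ∪ R₂ → ∀ {t u} → Step Rs t u → Step R₁ t u ⊎ Step R₂ t u
    step-split R₁ {R₂} inc (root m σ) with ∈-++⁻ R₁ {R₂} (inc m)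
    ... | inj₁ m₁ = inj₁ (root m₁ σ)
    ... | inj₂ m₂ = inj₂ (root m₂ σ)
    step-split R₁ inc (inner p)  = Sum.map inner inner (args-split R₁ inc p)

    args-split : ∀ {Rs} R₁ {R₂} → Rs ⊆ₗ R₁ ∪ R₂ → ∀ {n} {ts us : Vec Term n} →
                 StepArgs Rs ts us → StepArgs R₁ ts us ⊎ StepArgs R₂ ts us
    args-split R₁ inc (here p)  = Sum.map here here (step-split R₁ inc p)
    args-split R₁ inc (there p) = Sum.map there there (args-split R₁ inc p)

  rel-mono : ∀ {R S R′ S′} → R ⊆ₗ R′ → S ⊆ₗ S′ →
             ∀ {m t u} → Iter (RelStep R S) m t u → Iter (RelStep R′ S′) m t u
  rel-mono incR incS refl = refl
  rel-mono incR incS (step (t′ , u′ , pre , r , post) it) =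
    step (t′ , u′ , star-mono incS pre , step-mono incR r , star-mono incS post) (rel-mono incR incS it)

  RelDerivation : TRS → TRS → ℕ → Term → Set
  RelDerivation R S m t = Σ Term (Iter (RelStep R S) m t)

  absorb : ∀ {R S m t₀ t} → Star (Step S) t₀ t → RelDerivation R S m t → RelDerivation R S m t₀
  absorb {t₀ = t₀} pre (_ , refl) = t₀ , refl
  absorb pre (w , step (t′ , u′ , pre′ , r , post) it) = w , step (t′ , u′ , pre ◅◅ pre′ , r , post) it

  module Interpretation {d : ℕ} (M : MatrixInterpretation d) where
    open MI M
    open MatrixInterpretation M
    open MatrixAlgebra (suc d)

    α₀ : Assignment
    α₀ _ = 0v

    pot : Term → ℕ
    pot t = eval α₀ t zero

    mutual
      eval-subst : ∀ c α t σ i → evalWith c α (t · σ) i ≡ evalWith c (λ x → evalWith c α (σ x)) t i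
      eval-subst c α (var x)    σ i = refl
      eval-subst c α (fun f ts) σ i = cong (_+ c f i) (evalArgs-subst c α (coeff f) ts σ i)

      evalArgs-subst : ∀ {n} c α (Fs : Fin n → Mat) (ts : Vec Term n) σ i →
        evalArgs c α Fs (ts ·s σ) i ≡ evalArgs c (λ x → evalWith c α (σ x)) Fs ts i
      evalArgs-subst c α Fs []       σ i = refl
      evalArgs-subst c α Fs (t ∷ ts) σ i =
        cong₂ _+_ (*v-cong (Fs zero) (λ j → eval-subst c α t σ j) i)
                  (evalArgs-subst c α (λ j → Fs (suc j)) ts σ i)

    instance-lift : ∀ (_∼_ : ℕ → ℕ → Set) l r σ α i → (∀ β → eval β r i ∼ eval β l i) →
                    eval α (r · σ) i ∼ eval α (l · σ) i
    instance-lift _∼_ l r σ α i h =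
      subst₂ _∼_ (sym (eval-subst const α r σ i)) (sym (eval-subst const α l σ i)) (h _)

    mutual
      eval-affine : ∀ β t i → eval β t i ≡ ncp β t i + eval α₀ t i
      eval-affine β (var x)    i = sym (+-identityʳ _)
      eval-affine β (fun f ts) i = begin
          evalArgs const β (coeff f) ts i + c  ≡⟨ cong (_+ c) (evalArgs-affine β (coeff f) ts i) ⟩
          a + b + c                            ≡⟨ +-assoc a b c ⟩
          a + (b + c)                          ≡⟨ cong (_+ (b + c)) (sym (+-identityʳ a)) ⟩
          a + 0 + (b + c)                      ∎
        where
          open ≡-Reasoning
          a = evalArgs (λ _ → 0v) β (coeff f) ts i
          b = evalArgs const α₀ (coeff f) ts i
          c = const f i

      evalArgs-affine : ∀ {n} β (Fs : Fin n → Mat) (ts : Vec Term n) i →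
        evalArgs const β Fs ts i ≡ evalArgs (λ _ → 0v) β Fs ts i + evalArgs const α₀ Fs ts i
      evalArgs-affine β Fs []       i = refl
      evalArgs-affine {suc n} β Fs (t ∷ ts) i = begin
          (F *v eval β t) i + evalArgs const β Fs′ ts i
            ≡⟨ cong₂ _+_ (*v-cong F (λ j → eval-affine β t j) i) (evalArgs-affine β Fs′ ts i) ⟩
          (F *v (ncp β t +v eval α₀ t)) i + (x + y)
            ≡⟨ cong (_+ (x + y)) (*v-+ F (ncp β t) (eval α₀ t) i) ⟩
          (a + b) + (x + y)
            ≡⟨ interchange a b x y ⟩
          (a + x) + (b + y) ∎
        where
          open ≡-Reasoning
          F : Mat
          F = Fs zero
          Fs′ : Fin n → Mat
          Fs′ j = Fs (suc j)
          a = (F *v ncp β t) i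
          b = (F *v eval α₀ t) i
          x = evalArgs (λ _ → 0v) β Fs′ ts i
          y = evalArgs const α₀ Fs′ ts i

    ncp≤eval : ∀ β t i → ncp β t i ≤ eval β t i
    ncp≤eval β t i = subst (ncp β t i ≤_) (sym (eval-affine β t i)) (m≤m+n _ _)

    mutual
      weak-step : ∀ {Rs} → Rs ⊆ _≿M_ → ∀ {t u} → Step Rs t u → ∀ α → eval α t ≿ eval α u
      weak-step h (root {ρ} m σ) α i = instance-lift _≤_ (lhs ρ) (rhs ρ) σ α i (λ β → h ρ m β i)
      weak-step h (inner {f} p)  α i = +-monoˡ-≤ (const f i) (weak-args h p α (coeff f) i)

      weak-args : ∀ {Rs} → Rs ⊆ _≿M_ → ∀ {n} {ts us : Vec Term n} → StepArgs Rs ts us →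
        ∀ α (Fs : Fin n → Mat) i → evalArgs const α Fs us i ≤ evalArgs const α Fs ts i
      weak-args h (here p)  α Fs i = +-monoˡ-≤ _ (*v-mono (Fs zero) (weak-step h p α) i)
      weak-args h (there p) α Fs i = +-monoʳ-≤ _ (weak-args h p α (λ j → Fs (suc j)) i)

    *v-strict : ∀ F {u v : Vect} → 1 ≤ F zero zero → u ≻ v → (F *v v) zero < (F *v u) zero
    *v-strict F pos (lt , le) =
      +-mono-<-≤ (*-monoʳ-< (F zero zero) ⦃ >-nonZero pos ⦄ lt)
                 (∑-mono d (λ j → *-monoʳ-≤ (F zero (suc j)) (le (suc j))))

    -- ≻ is closed under substitutions and contexts (using (F_i)₁₁ ≥ 1).
    mutual
      strict-step : ∀ {Rs} → Rs ⊆ _≻M_ → ∀ {t u} → Step Rs t u → ∀ α → eval α t ≻ eval α u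
      strict-step h s α = strict-first h s α , weak-step (λ ρ m β → proj₂ (h ρ m β)) s α

      strict-first : ∀ {Rs} → Rs ⊆ _≻M_ → ∀ {t u} → Step Rs t u → ∀ α → eval α u zero < eval α t zero
      strict-first h (root {ρ} m σ) α = instance-lift _<_ (lhs ρ) (rhs ρ) σ α zero (λ β → proj₁ (h ρ m β))
      strict-first h (inner {f} p)  α = +-monoˡ-< (const f zero) (strict-args h p α (coeff f) (coeff-pos f))

      strict-args : ∀ {Rs} → Rs ⊆ _≻M_ → ∀ {n} {ts us : Vec Term n} → StepArgs Rs ts us →
        ∀ α (Fs : Fin n → Mat) → (∀ j → 1 ≤ Fs j zero zero) →
        evalArgs const α Fs us zero < evalArgs const α Fs ts zero
      strict-args h (here p)  α Fs pos = +-monoˡ-< _ (*v-strict (Fs zero) (pos zero) (strict-step h p α))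
      strict-args h (there p) α Fs pos = +-monoʳ-< _ (strict-args h p α (λ j → Fs (suc j)) (λ j → pos (suc j)))

    -- Argument positions (f, i), and the product of coefficient matrices
    -- along a path of them: the factor a context applies to its hole.
    Path : Set
    Path = List (Σ Sym λ f → Fin (ar f))

    pathMat : Path → Mat
    pathMat ps = prodM (map (λ p → coeff (proj₁ p) (proj₂ p)) ps)

    Increment : TRS → Vect → Set
    Increment Rs e = ∀ ρ → ρ ∈ Rs → ∀ β i → eval β (rhs ρ) i ≤ eval β (lhs ρ) i + e i

    mutual
      step-increment : ∀ {Rs} e → Increment Rs e → ∀ {t u} → Step Rs t u →
        Σ Path λ ps → ∀ α i → eval α u i ≤ eval α t i + (pathMat ps *v e) i
      step-increment e h (root {ρ} m σ) =
        [] , λ α i → subst (λ x → eval α (rhs ρ · σ) i ≤ eval α (lhs ρ · σ) i + x) (sym (Id-*v e i))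
                           (instance-lift (λ a b → a ≤ b + e i) (lhs ρ) (rhs ρ) σ α i (λ β → h ρ m β i))
      step-increment e h (inner {f} {ts} {us} p) with args-increment e h p (coeff f)
      ... | j , ps , b = ((f , j) ∷ ps) , increase
        where
          increase : ∀ α i → evalArgs const α (coeff f) us i + const f i ≤
                          evalArgs const α (coeff f) ts i + const f i + (pathMat ((f , j) ∷ ps) *v e) i
          increase α i = ≤-trans (+-monoˡ-≤ (const f i) (b α i))
                              (≤-reflexive (xy∙z≈xz∙y (evalArgs const α (coeff f) ts i) _ (const f i)))

      args-increment : ∀ {Rs} e → Increment Rs e → ∀ {n} {ts us : Vec Term n} → StepArgs Rs ts us →
        (Fs : Fin n → Mat) → Σ (Fin n) λ j → Σ Path λ ps → ∀ α i →
        evalArgs const α Fs us i ≤ evalArgs const α Fs ts i + ((Fs j *M pathMat ps) *v e) i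
      args-increment e h (here {t = t} {u} {ts} p) Fs with step-increment e h p
      ... | ps , b = zero , ps , increase
        where
          F : Mat
          F = Fs zero
          increase : ∀ α i → evalArgs const α Fs (u ∷ ts) i ≤ evalArgs const α Fs (t ∷ ts) i + ((F *M pathMat ps) *v e) i
          increase α i = begin
              (F *v eval α u) i + rest                          ≤⟨ +-monoˡ-≤ rest (*v-mono F (b α) i) ⟩
              (F *v (eval α t +v (pathMat ps *v e))) i + rest   ≡⟨ cong (_+ rest) (*v-+ F (eval α t) (pathMat ps *v e) i) ⟩
              (F *v eval α t) i + (F *v (pathMat ps *v e)) i + rest
                ≡⟨ cong (λ x → (F *v eval α t) i + x + rest) (sym (*v-assoc F (pathMat ps) e i)) ⟩
              (F *v eval α t) i + X + rest                      ≡⟨ xy∙z≈xz∙y ((F *v eval α t) i) X rest ⟩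
              (F *v eval α t) i + rest + X                      ∎
            where
              open ≤-Reasoning
              X = ((F *M pathMat ps) *v e) i
              rest = evalArgs const α (λ j → Fs (suc j)) ts i
      args-increment e h (there {t = t} p) Fs with args-increment e h p (λ j → Fs (suc j))
      ... | j , ps , b = suc j , ps , λ α i →
        ≤-trans (+-monoʳ-≤ ((Fs zero *v eval α t) i) (b α i)) (≤-reflexive (sym (+-assoc ((Fs zero *v eval α t) i) _ _)))

    rhsConstants : TRS → Vect
    rhsConstants []       = 0v
    rhsConstants (ρ ∷ Rs) = eval α₀ (rhs ρ) +v rhsConstants Rs

    rhsConstant≤ : ∀ {ρ Rs} → ρ ∈ Rs → ∀ i → eval α₀ (rhs ρ) i ≤ rhsConstants Rs i
    rhsConstant≤ (here refl) i = m≤m+n _ _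
    rhsConstant≤ (there m)   i = ≤-trans (rhsConstant≤ m i) (m≤n+m _ _)

    ncp-increment : ∀ {Rs} → Rs ⊆ _≿ncp_ → Increment Rs (rhsConstants Rs)
    ncp-increment {Rs} h ρ m β i = begin
        eval β (rhs ρ) i                          ≡⟨ eval-affine β (rhs ρ) i ⟩
        ncp β (rhs ρ) i + eval α₀ (rhs ρ) i       ≤⟨ +-mono-≤ (h ρ m β i) (rhsConstant≤ m i) ⟩
        ncp β (lhs ρ) i + rhsConstants Rs i       ≤⟨ +-monoˡ-≤ _ (ncp≤eval β (lhs ρ) i) ⟩
        eval β (lhs ρ) i + rhsConstants Rs i      ∎
      where open ≤-Reasoning

    module ConstantGrowthBounds (A : Mat) (bounded : ∀ ps → pathMat ps ≤M A) where

      increment-bound : ∀ {Rs} e → Increment Rs e → ∀ {t u} → Step Rs t u →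
                        pot u ≤ pot t + (A *v e) zero
      increment-bound e h {t} s with step-increment e h s
      ... | ps , b = ≤-trans (b α₀ zero) (+-monoʳ-≤ (pot t) (*v-monoˡ (pathMat ps) A (bounded ps) e zero))

      -- G i bounds the i-th component contributed by one symbol occurrence.
      G : Vect
      G i = ∑ k (λ f → (A *v const f) i)

      Admissible : Mat → Set
      Admissible P = ∀ ps → (P *M pathMat ps) ≤M A

      admissible-extend : ∀ P f j → Admissible P → Admissible (P *M coeff f j)
      admissible-extend P f j adm ps a b =
        subst (_≤ A a b) (sym (*M-assoc P (coeff f j) (pathMat ps) a b)) (adm ((f , j) ∷ ps) a b)

      admissible-≤A : ∀ {P} → Admissible P → P ≤M A
      admissible-≤A {P} adm a b = subst (_≤ A a b) (*M-Id P a b) (adm [] a b)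

      mutual
        value-bound : ∀ P → Admissible P → ∀ t i → (P *v eval α₀ t) i ≤ size t * G i
        value-bound P adm (var x)    i = ≤-trans (≤-reflexive (*v-0 P i)) z≤n
        value-bound P adm (fun f ts) i = begin
            (P *v (evalArgs const α₀ (coeff f) ts +v const f)) i
              ≡⟨ *v-+ P (evalArgs const α₀ (coeff f) ts) (const f) i ⟩
            (P *v evalArgs const α₀ (coeff f) ts) i + (P *v const f) i
              ≤⟨ +-mono-≤ (values-bound P (coeff f) (λ j → admissible-extend P f j adm) ts i)
                          (*v-monoˡ P A (admissible-≤A adm) (const f) i) ⟩
            sizes ts * G i + (A *v const f) i
              ≤⟨ +-monoʳ-≤ (sizes ts * G i) (∑-term k (λ f′ → (A *v const f′) i) f) ⟩
            sizes ts * G i + G i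
              ≡⟨ +-comm (sizes ts * G i) (G i) ⟩
            suc (sizes ts) * G i ∎
          where open ≤-Reasoning

        values-bound : ∀ {n} P (Fs : Fin n → Mat) → (∀ j → Admissible (P *M Fs j)) → ∀ (ts : Vec Term n) i →
          (P *v evalArgs const α₀ Fs ts) i ≤ sizes ts * G i
        values-bound P Fs adm []       i = ≤-reflexive (*v-0 P i)
        values-bound P Fs adm (t ∷ ts) i = begin
            (P *v ((Fs zero *v eval α₀ t) +v rest)) i
              ≡⟨ *v-+ P (Fs zero *v eval α₀ t) rest i ⟩
            (P *v (Fs zero *v eval α₀ t)) i + (P *v rest) i
              ≡⟨ cong (_+ (P *v rest) i) (sym (*v-assoc P (Fs zero) (eval α₀ t) i)) ⟩
            ((P *M Fs zero) *v eval α₀ t) i + (P *v rest) i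
              ≤⟨ +-mono-≤ (value-bound (P *M Fs zero) (adm zero) t i)
                          (values-bound P (λ j → Fs (suc j)) (λ j → adm (suc j)) ts i) ⟩
            size t * G i + sizes ts * G i
              ≡⟨ sym (*-distribʳ-+ (G i) (size t) (sizes ts)) ⟩
            (size t + sizes ts) * G i ∎
          where
            open ≤-Reasoning
            rest = evalArgs const α₀ (λ j → Fs (suc j)) ts

      pot-bound : ∀ t → pot t ≤ size t * G zero
      pot-bound t = subst (_≤ size t * G zero) (Id-*v (eval α₀ t) zero)
        (value-bound Id (λ ps a b → subst (_≤ A a b) (sym (Id-*M (pathMat ps) a b)) (bounded ps a b)) t zero)

      module Counting (R₁ R₂ S : TRS) (h₁ : R₁ ⊆ _≿ncp_) (h₂ : R₂ ⊆ _≻M_) (hS : S ⊆ _≿M_) where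

        S′ : TRS
        S′ = R₂ ∪ S

        weak-S′ : S′ ⊆ _≿M_
        weak-S′ ρ m with ∈-++⁻ R₂ m
        ... | inj₁ m₂ = λ α → proj₂ (h₂ ρ m₂ α)
        ... | inj₂ mS = hS ρ mS

        lift : ∀ {t u} → Star (Step S) t u → Star (Step S′) t u
        lift = star-mono (∈-++⁺ʳ R₂)

        E : ℕ
        E = (A *v rhsConstants R₁) zero

        S′-pot : ∀ {t u} → Star (Step S′) t u → pot u ≤ pot t
        S′-pot ε        = ≤-refl
        S′-pot (s ◅ ss) = ≤-trans (S′-pot ss) (weak-step weak-S′ s α₀ zero)

        R₁-pot : ∀ {t u} → Step R₁ t u → pot u ≤ pot t + E
        R₁-pot = increment-bound (rhsConstants R₁) (ncp-increment h₁)

        R₂-pot : ∀ {t u} → Step R₂ t u → pot u < pot t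
        R₂-pot s = strict-first h₂ s α₀

        R₁-relstep-pot : ∀ {t t′ u′ v} → Star (Step S) t t′ → Step R₁ t′ u′ → Star (Step S) u′ v →
                         pot v ≤ pot t + E
        R₁-relstep-pot pre r post =
          ≤-trans (S′-pot (lift post)) (≤-trans (R₁-pot r) (+-monoˡ-≤ E (S′-pot (lift pre))))

        R₂-relstep-pot : ∀ {t t′ u′ v} → Star (Step S) t t′ → Step R₂ t′ u′ → Star (Step S) u′ v →
                         pot v < pot t
        R₂-relstep-pot pre r post =
          ≤-trans (s≤s (S′-pot (lift post))) (≤-trans (R₂-pot r) (S′-pot (lift pre)))

        after-R₁ : ∀ {m p q r m₁} → q ≤ r + E → m + p ≤ q + suc E * m₁ → suc m + p ≤ r + suc E * suc m₁
        after-R₁ {m} {p} {q} {r} {m₁} q≤ ineq = begin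
            suc (m + p)               ≤⟨ s≤s ineq ⟩
            suc (q + suc E * m₁)      ≤⟨ s≤s (+-monoˡ-≤ (suc E * m₁) q≤) ⟩
            suc (r + E + suc E * m₁)  ≡⟨ suc-distrib r E m₁ ⟩
            r + suc E * suc m₁        ∎
          where open ≤-Reasoning

        after-R₂ : ∀ {m p q r x} → q < r → m + p ≤ q + x → suc m + p ≤ r + x
        after-R₂ {x = x} q<r ineq = ≤-trans (s≤s ineq) (+-monoˡ-≤ x q<r)

        -- An R/S-derivation of length m splits into an R₁/(R₂ ∪ S)-derivation
        -- of some length m₁ and at most pot t + E·m₁ further R₂-steps;
        -- the potential of the end term is carried along as an invariant.
        count : ∀ {R} → R ⊆ₗ R₁ ∪ R₂ → ∀ {m t u} → Iter (RelStep R S) m t u →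
                Σ ℕ λ m₁ → RelDerivation R₁ S′ m₁ t × (m + pot u ≤ pot t + suc E * m₁)
        count inc refl = 0 , (_ , refl) , m≤m+n _ _
        count inc (step {m = m} {v = u} (t′ , u′ , pre , r , post) it) with step-split R₁ inc r | count inc it
        ... | inj₁ r₁ | m₁ , (w , der) , ineq =
          suc m₁ , (w , step (t′ , u′ , lift pre , r₁ , lift post) der) ,
          after-R₁ {m} {pot u} (R₁-relstep-pot pre r₁ post) ineq
        ... | inj₂ r₂ | m₁ , der , ineq =
          m₁ , absorb (lift pre ◅◅ step-mono ∈-++⁺ˡ r₂ ◅ lift post) der ,
          after-R₂ {m} {pot u} (R₂-relstep-pot pre r₂ post) ineq

  SoundAt : CPProcessor → CPProblem → Set₁
  SoundAt Φ P = Σ ℕ λ c → Σ ℕ λ N → ∀ n → N ≤ n → ∀ K → RhsBound n (Φ P) K → CpBound P n (c * K)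

  singleton-rhs : ∀ {n T K} → RhsBound n (T ∷ []) K →
                  Σ ℕ λ b → CpBound (prob T) n b × K ≡ bound T n + b + 0
  singleton-rhs (cb ∷ []) = _ , cb , refl

  sound-singleton : ∀ {Φ P T} → Φ P ≡ T ∷ [] → (c : ℕ) →
    (∀ n b → CpBound (prob T) n b → CpBound P n (c * (bound T n + b + 0))) → SoundAt Φ P
  sound-singleton {P = P} eq c transfer = c , 0 , λ n _ K rb →
    let (b , cb , K≡) = singleton-rhs (subst (λ Ts → RhsBound n Ts K) eq rb)
    in subst (CpBound P n) (cong (c *_) (sym K≡)) (transfer n b cb)

  -- Fallback case: the output problem contains the input problem, so its
  -- complexity already bounds that of the input.
  unchanged-transfer : ∀ P T → R P ⊆ₗ R (prob T) → S P ⊆ₗ S (prob T) → L (prob T) ≡ L P →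
    ∀ n b → CpBound (prob T) n b → CpBound P n (1 * (bound T n + b + 0))
  unchanged-transfer P T incR incS eL n b cb t Lt sz m u der =
    ≤-trans (cb t (subst (λ L′ → L′ t) (sym eL) Lt) sz m u (rel-mono incR incS der))
            (subst (b ≤_) (sym (trans (*-identityˡ _) (+-identityʳ _))) (m≤n+m b (bound T n)))

  -- Main case: a derivation of t with m steps has m₁ ≤ b steps in R₁ and
  -- m ≤ pot t + (1+E)·m₁ ≤ G·n + (1+E)·b, which is O(n + b).
  split-transfer : ∀ P T R₁ R₂ → Applicable P R₁ R₂ →
    R₁ ⊆ₗ R (prob T) → R₂ ∪ S P ⊆ₗ S (prob T) → L (prob T) ≡ L P → (∀ n → bound T n ≡ n) →
    Σ ℕ λ c → ∀ n b → CpBound (prob T) n b → CpBound P n (c * (bound T n + b + 0))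
  split-transfer P T R₁ R₂ (R≈ , _ , M , (A , bounded) , h₁ , h₂ , hS) incR incS eL f≡id =
    G zero + suc E , λ n b cb t Lt sz m u der →
      let (m₁ , (_ , der₁) , inv) = count (λ ρ∈R → proj₁ (R≈ _) ρ∈R) der
          m₁≤b = cb t (subst (λ L′ → L′ t) (sym eL) Lt) sz m₁ _ (rel-mono incR incS der₁)
      in begin
        m                                 ≤⟨ m≤m+n m (pot u) ⟩
        m + pot u                         ≤⟨ inv ⟩
        pot t + suc E * m₁                ≤⟨ +-mono-≤ (pot-bound t) (*-monoʳ-≤ (suc E) m₁≤b) ⟩
        size t * G zero + suc E * b       ≤⟨ +-monoˡ-≤ (suc E * b) (≤-trans (*-monoˡ-≤ (G zero) sz)
                                                                         (≤-reflexive (*-comm n (G zero)))) ⟩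
        G zero * n + suc E * b            ≤⟨ linear-combination (G zero) (suc E) n b ⟩
        (G zero + suc E) * (n + b + 0)    ≡⟨ cong (λ x → (G zero + suc E) * (x + b + 0)) (sym (f≡id n)) ⟩
        (G zero + suc E) * (bound T n + b + 0) ∎
    where
      open Interpretation M
      open ConstantGrowthBounds A bounded
      open Counting R₁ R₂ (S P) h₁ h₂ hS
      open ≤-Reasoning

theorem7p4 : (k : ℕ) (ar : Fin k → ℕ) (Φ : Sig.CPProcessor k ar) →
    Sig.IsProcessor7p4 k ar Φ → Sig.Sound k ar Φ
theorem7p4 k ar Φ isΦ P = case isΦ P of λ where
    (inj₁ (R₁ , R₂ , applicable , T , Φ≡ , R≈ , S≈ , L≡ , f≡id)) →
      let (c , transfer) = split-transfer P T R₁ R₂ applicable (proj₂ (R≈ _)) (proj₂ (S≈ _)) L≡ f≡id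
      in sound-singleton {Φ} Φ≡ c transfer
    (inj₂ (_ , T , Φ≡ , R≈ , S≈ , L≡ , _)) →
      sound-singleton {Φ} Φ≡ 1 (unchanged-transfer P T (proj₂ (R≈ _)) (proj₂ (S≈ _)) L≡)
  where open OverSignature k ar
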